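{- Fix $\epsilon>0$, $d>2\epsilon$, and an integer $m\ge \frac{d}{\epsilon(d-2\epsilon)}$. Suppose $\mathcal H$ is a 3-uniform hypergraph with $V(\mathcal H)=V_1\cup V_2\cup V_3$ (pairwise disjoint), $|V_1|=|V_3|=m$, $|V_2|=2m$, and $(V_1,V_2,V_3)$ is $(\epsilon,d)$-regular. Then $\mathcal H$ contains a loose path omitting at most $8\epsilon m/d+3$ vertices of $\mathcal H$.
   Context: For mutually disjoint nonempty vertex sets $A_1,A_2,A_3$ of a 3-graph, $e(A_1,A_2,A_3)$ is the number of edges with exactly one vertex in each $A_i$, and $d(A_1,A_2,A_3)=\frac{e(A_1,A_2,A_3)}{|A_1||A_2||A_3|}$. A triple $(V_1,V_2,V_3)$ of mutually disjoint vertex sets is $\epsilon$-regular if $|d(A_1,A_2,A_3)-d(V_1,V_2,V_3)|\le\epsilon$ for all $A_i\subseteq V_i$ with $|A_i|\ge\epsilon|V_i|$ ($i\in[3]$); it is $(\epsilon,d)$-regular if it is $\epsilon$-regular and $d(V_1,V_2,V_3)\ge d$. A loose path $v_1v_2\cdots v_{2k+1}$ is a 3-graph on distinct vertices $v_1,\dots,v_{2k+1}$ with edges $v_{2i-1}v_{2i}v_{2i+1}$ for $i\in[k]$.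
   Formalization: The parameters ε and d are taken in the rationals. -}

module Defs where

open import Data.Nat as ℕ using (ℕ; zero; suc)
open import Data.Integer using (+_)
open import Data.Rational using (ℚ; 0ℚ; _/_; _≤_; ∣_∣; _-_; _*_; _÷_; _≟_; ≢-nonZero)
open import Relation.Nullary using (yes; no)
open import Data.Fin using (Fin; toℕ; fromℕ<)
open import Data.Fin.Subset using (Subset; _∈_; _∉_; _⊆_) renaming (∣_∣ to size)
open import Data.Bool using (Bool; true; false; if_then_else_; _∧_)
open import Data.Nat.Properties using (≤-refl)
open import Relation.Binary.PropositionalEquality using (_≡_; _≢_)
open import Relation.Nullary.Decidable using (does)
open import Data.Fin.Subset.Properties using (_∈?_)
open import Data.List using (List; map; allFin)
open import Data.Nat.ListAction using (sum)
open import Data.Product using (_×_; Σ; ∃)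
open import Data.Sum using (_⊎_)
open import Function.Definitions using (Injective)

ℕtoℚ : ℕ → ℚ
ℕtoℚ n = + n / 1

-- Rational division p / q; only ever applied with q ≠ 0 below
-- (the value 0 for q = 0 is an irrelevant convention).
_÷'_ : ℚ → ℚ → ℚ
p ÷' q with q ≟ 0ℚ
... | yes _ = 0ℚ
... | no q≢0 = _÷_ p q {{≢-nonZero q≢0}}

-- Edges are 3-element sets
-- {x,y,z}; they are encoded by a Boolean indicator on ordered triples
-- which is invariant under permutations and only true on triples of
-- distinct vertices.
record ThreeGraph (n : ℕ) : Set where
  field
    edge     : Fin n → Fin n → Fin n → Bool
    distinct₁₂ : ∀ x y z → edge x y z ≡ true → x ≢ y
    distinct₂₃ : ∀ x y z → edge x y z ≡ true → y ≢ z
    distinct₁₃ : ∀ x y z → edge x y z ≡ true → x ≢ z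
    sym₁₂    : ∀ x y z → edge x y z ≡ edge y x z
    sym₂₃    : ∀ x y z → edge x y z ≡ edge x z y
open ThreeGraph public

count : {n : ℕ} → (Fin n → Bool) → ℕ
count {n} p = sum (map (λ x → if p x then 1 else 0) (allFin n))

-- e(A₁,A₂,A₃): number of edges with exactly one vertex in each Aᵢ.
-- For pairwise disjoint Aᵢ each such edge corresponds to exactly one
-- ordered triple (x,y,z) ∈ A₁×A₂×A₃, so we count those triples.
eCount : {n : ℕ} → ThreeGraph n → Subset n → Subset n → Subset n → ℕ
eCount {n} H A₁ A₂ A₃ =
  sum (map (λ x → sum (map (λ y →
    count (λ z → does (x ∈? A₁) ∧ does (y ∈? A₂) ∧ does (z ∈? A₃) ∧ edge H x y z))
    (allFin n))) (allFin n))

-- d(A₁,A₂,A₃) = e(A₁,A₂,A₃) / (|A₁||A₂||A₃|)   (0 if some Aᵢ is empty;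
-- this case never arises where the density is used).
density : {n : ℕ} → ThreeGraph n → Subset n → Subset n → Subset n → ℚ
density H A₁ A₂ A₃ with size A₁ ℕ.* size A₂ ℕ.* size A₃
... | zero  = 0ℚ
... | suc k = + eCount H A₁ A₂ A₃ / suc k

IsRegular : {n : ℕ} → ThreeGraph n → ℚ → Subset n → Subset n → Subset n → Set
IsRegular H ε V₁ V₂ V₃ =
  ∀ (A₁ A₂ A₃ : Subset _) →
    A₁ ⊆ V₁ → A₂ ⊆ V₂ → A₃ ⊆ V₃ →
    ε * ℕtoℚ (size V₁) ≤ ℕtoℚ (size A₁) →
    ε * ℕtoℚ (size V₂) ≤ ℕtoℚ (size A₂) →
    ε * ℕtoℚ (size V₃) ≤ ℕtoℚ (size A₃) →
    ∣ density H A₁ A₂ A₃ - density H V₁ V₂ V₃ ∣ ≤ ε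

IsRegularWith : {n : ℕ} → ThreeGraph n → ℚ → ℚ → Subset n → Subset n → Subset n → Set
IsRegularWith H ε d V₁ V₂ V₃ =
  IsRegular H ε V₁ V₂ V₃ × d ≤ density H V₁ V₂ V₃

record LoosePath {n : ℕ} (H : ThreeGraph n) (k : ℕ) : Set where
  field
    vtx       : Fin (suc (2 ℕ.* k)) → Fin n
    injective : Injective _≡_ _≡_ vtx
    edges     : ∀ (i : ℕ) → i ℕ.< k →
      (p : 2 ℕ.* i ℕ.< suc (2 ℕ.* k))
      (q : suc (2 ℕ.* i) ℕ.< suc (2 ℕ.* k))
      (r : suc (suc (2 ℕ.* i)) ℕ.< suc (2 ℕ.* k)) →
        edge H (vtx (fromℕ< p)) (vtx (fromℕ< q)) (vtx (fromℕ< r)) ≡ true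
open LoosePath public

{-# OPTIONS --safe #-}
-- Depth-first search.  A loose path is grown at its free end x, which alternates between V₁ and V₃:
-- it is extended by an edge x y z with y ∈ V₂ and z in the other outer part, both unvisited.  When there
-- is no such edge, x and its neighbour on the path die (a path consisting of x alone dies and restarts at
-- an unvisited vertex of V₁).  A dead outer vertex has no edge into the unvisited vertices of V₂ and of
-- the opposite outer part.  Regularity puts an edge into any three sets of at least ε|V₁|, ε|V₂|,
-- ε|V₃| vertices, since an edgeless triple has density 0 while d(V₁,V₂,V₃) ≥ d > ε.  So while every
-- part keeps that many unvisited vertices, fewer than εm vertices of each outer part are dead, and every
-- dead vertex of V₂ died together with an outer one.  Once some part runs short, counting its vertices
-- shows that at most 8εm + 3 ≤ 8εm/d + 3 vertices are off the path.
module Submission where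

open import Defs
open import Data.Bool using (Bool; true; false; if_then_else_; _∧_; not)
open import Data.Empty using (⊥; ⊥-elim)
open import Data.Fin using (Fin; zero; suc)
import Data.Nat as ℕ
open import Data.Nat using (ℕ)
import Data.Rational as ℚ
open import Data.Product using (Σ; _×_; _,_; proj₁; proj₂; ∃; ∃-syntax; swap)
open import Data.Sum using (_⊎_; inj₁; inj₂)
open import Function using (_∘_; _⇔_; mk⇔; Equivalence)
open import Relation.Binary.PropositionalEquality
open import Relation.Nullary using (¬_; Dec; yes; no; does; contradiction)
open import Relation.Nullary.Decidable using (map′; _×-dec_; ¬?; does-≡; dec-true)
open import Relation.Unary using (Decidable)

module Rationals where
  open import Data.Nat as ℕ using (ℕ; zero; suc; z≤n; s≤s)
  open import Data.Integer as ℤ using (+_)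
  import Data.Integer.Properties as ℤ
  open import Data.Rational
    using (0ℚ; 1ℚ; _≤_; _<_; _+_; _*_; _-_; -_; _/_; _÷_; 1/_; toℚᵘ; _≟_; ≢-nonZero; NonZero; Positive; NonNegative;
           positive; nonNegative)
  open import Data.Rational.Properties
  import Data.Rational.Unnormalised as ℚᵘ
  import Data.Rational.Unnormalised.Properties as ℚᵘ
  open import Data.Rational.Solver using (module +-*-Solver)

  private
    ℕtoℚᵘ : ℕ → ℚᵘ.ℚᵘ
    ℕtoℚᵘ k = ℚᵘ.mkℚᵘ (+ k) 0

    toℚᵘ-ℕtoℚ : ∀ k → toℚᵘ (ℕtoℚ k) ℚᵘ.≃ ℕtoℚᵘ k
    toℚᵘ-ℕtoℚ k = toℚᵘ-fromℚᵘ (ℕtoℚᵘ k)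

  ℕtoℚ-+ : ∀ a b → ℕtoℚ (a ℕ.+ b) ≡ ℕtoℚ a + ℕtoℚ b
  ℕtoℚ-+ a b = toℚᵘ-injective (begin
    toℚᵘ (ℕtoℚ (a ℕ.+ b))            ≈⟨ toℚᵘ-ℕtoℚ (a ℕ.+ b) ⟩
    ℕtoℚᵘ (a ℕ.+ b)                  ≈⟨ ℚᵘ.*≡* (trans (ℤ.*-identityʳ _) (sym (trans (ℤ.*-identityʳ _)
                                          (cong₂ ℤ._+_ (ℤ.*-identityʳ (+ a)) (ℤ.*-identityʳ (+ b)))))) ⟩
    ℕtoℚᵘ a ℚᵘ.+ ℕtoℚᵘ b             ≈⟨ ℚᵘ.+-cong (ℚᵘ.≃-sym (toℚᵘ-ℕtoℚ a)) (ℚᵘ.≃-sym (toℚᵘ-ℕtoℚ b)) ⟩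
    toℚᵘ (ℕtoℚ a) ℚᵘ.+ toℚᵘ (ℕtoℚ b) ≈⟨ ℚᵘ.≃-sym (toℚᵘ-homo-+ (ℕtoℚ a) (ℕtoℚ b)) ⟩
    toℚᵘ (ℕtoℚ a + ℕtoℚ b)           ∎)
    where open ℚᵘ.≃-Reasoning

  ℕtoℚ-* : ∀ a b → ℕtoℚ (a ℕ.* b) ≡ ℕtoℚ a * ℕtoℚ b
  ℕtoℚ-* a b = toℚᵘ-injective (begin
    toℚᵘ (ℕtoℚ (a ℕ.* b))            ≈⟨ toℚᵘ-ℕtoℚ (a ℕ.* b) ⟩
    ℕtoℚᵘ (a ℕ.* b)                  ≈⟨ ℚᵘ.*≡* (trans (ℤ.*-identityʳ _) (sym (trans (ℤ.*-identityʳ _)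
                                          (sym (ℤ.pos-* a b))))) ⟩
    ℕtoℚᵘ a ℚᵘ.* ℕtoℚᵘ b             ≈⟨ ℚᵘ.*-cong (ℚᵘ.≃-sym (toℚᵘ-ℕtoℚ a)) (ℚᵘ.≃-sym (toℚᵘ-ℕtoℚ b)) ⟩
    toℚᵘ (ℕtoℚ a) ℚᵘ.* toℚᵘ (ℕtoℚ b) ≈⟨ ℚᵘ.≃-sym (toℚᵘ-homo-* (ℕtoℚ a) (ℕtoℚ b)) ⟩
    toℚᵘ (ℕtoℚ a * ℕtoℚ b)           ∎)
    where open ℚᵘ.≃-Reasoning

  ℕtoℚ-mono-≤ : ∀ {a b} → a ℕ.≤ b → ℕtoℚ a ≤ ℕtoℚ b
  ℕtoℚ-mono-≤ {a} {b} a≤b = toℚᵘ-cancel-≤ (begin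
    toℚᵘ (ℕtoℚ a) ≃⟨ toℚᵘ-ℕtoℚ a ⟩
    ℕtoℚᵘ a       ≤⟨ ℚᵘ.*≤* (ℤ.*-monoʳ-≤-nonNeg (+ 1) (ℤ.+≤+ a≤b)) ⟩
    ℕtoℚᵘ b       ≃⟨ ℚᵘ.≃-sym (toℚᵘ-ℕtoℚ b) ⟩
    toℚᵘ (ℕtoℚ b) ∎)
    where open ℚᵘ.≤-Reasoning

  ℕtoℚ-nonNeg : ∀ k → NonNegative (ℕtoℚ k)
  ℕtoℚ-nonNeg k = nonNegative (ℕtoℚ-mono-≤ {0} {k} z≤n)

  ÷′-≡ : ∀ p q (q≢0 : q ≢ 0ℚ) → p ÷' q ≡ _÷_ p q {{≢-nonZero q≢0}}
  ÷′-≡ p q q≢0 with q ≟ 0ℚ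
  ... | yes q≡0 = contradiction q≡0 q≢0
  ... | no _    = refl

  ÷′-pos : ∀ {p q} → 0ℚ < p → 0ℚ < q → 0ℚ < p ÷' q
  ÷′-pos {p} {q} 0<p 0<q = subst (0ℚ <_) (sym (÷′-≡ p q q≢0)) (positive⁻¹ (p * 1/ q))
    where
    q≢0 : q ≢ 0ℚ
    q≢0 = <⇒≢ 0<q ∘ sym
    instance
      p-pos : Positive p
      p-pos = positive 0<p
      q-pos : Positive q
      q-pos = positive 0<q
      q-nonZero : NonZero q
      q-nonZero = ≢-nonZero q≢0
      1/q-pos : Positive (1/ q)
      1/q-pos = 1/pos⇒pos q
      p/q-pos : Positive (p * 1/ q)
      p/q-pos = pos*pos⇒pos p (1/ q)

  ≤-÷′ : ∀ {p d} → 0ℚ ≤ p → 0ℚ < d → d ≤ 1ℚ → p ≤ p ÷' d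
  ≤-÷′ {p} {d} 0≤p 0<d d≤1 = begin
    p          ≡⟨ *-identityʳ p ⟨
    p * 1ℚ     ≤⟨ *-monoˡ-≤-nonNeg p 1≤1/d ⟩
    p * 1/ d   ≡⟨ ÷′-≡ p d d≢0 ⟨
    p ÷' d     ∎
    where
    open ≤-Reasoning
    d≢0 : d ≢ 0ℚ
    d≢0 = <⇒≢ 0<d ∘ sym
    instance
      d-pos : Positive d
      d-pos = positive 0<d
      d-nonZero : NonZero d
      d-nonZero = ≢-nonZero d≢0
      p-nonNeg : NonNegative p
      p-nonNeg = nonNegative 0≤p
    1≤1/d : 1ℚ ≤ 1/ d
    1≤1/d = *-cancelˡ-≤-pos d (subst₂ _≤_ (sym (*-identityʳ d)) (sym (*-inverseʳ d)) d≤1)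

  private
    four-doubles : ∀ τ → ℕtoℚ 4 * (τ + τ) ≡ ℕtoℚ 8 * τ
    four-doubles = +-*-Solver.solve 1 (λ τ → con (ℕtoℚ 4) :* (τ :+ τ) := con (ℕtoℚ 8) :* τ) refl
      where open +-*-Solver

    two-quadruples : ∀ τ → ℕtoℚ 2 * ((τ + τ) + (τ + τ)) ≡ ℕtoℚ 8 * τ
    two-quadruples = +-*-Solver.solve 1 (λ τ → con (ℕtoℚ 2) :* ((τ :+ τ) :+ (τ :+ τ)) := con (ℕtoℚ 8) :* τ) refl
      where open +-*-Solver

  leftover-outer : ∀ {τ} u a → ℕtoℚ u < τ → ℕtoℚ a < τ →
                   ℕtoℚ (4 ℕ.* (u ℕ.+ a) ℕ.+ 3) ≤ ℕtoℚ 8 * τ + ℕtoℚ 3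
  leftover-outer {τ} u a u<τ a<τ = begin
    ℕtoℚ (4 ℕ.* (u ℕ.+ a) ℕ.+ 3)         ≡⟨ ℕtoℚ-+ (4 ℕ.* (u ℕ.+ a)) 3 ⟩
    ℕtoℚ (4 ℕ.* (u ℕ.+ a)) + ℕtoℚ 3     ≡⟨ cong (_+ ℕtoℚ 3) (trans (ℕtoℚ-* 4 (u ℕ.+ a)) (cong (ℕtoℚ 4 *_) (ℕtoℚ-+ u a))) ⟩
    ℕtoℚ 4 * (ℕtoℚ u + ℕtoℚ a) + ℕtoℚ 3 ≤⟨ +-monoˡ-≤ (ℕtoℚ 3) (*-monoˡ-≤-nonNeg (ℕtoℚ 4) {{ℕtoℚ-nonNeg 4}}
                                              (+-mono-≤ (<⇒≤ u<τ) (<⇒≤ a<τ))) ⟩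
    ℕtoℚ 4 * (τ + τ) + ℕtoℚ 3           ≡⟨ cong (_+ ℕtoℚ 3) (four-doubles τ) ⟩
    ℕtoℚ 8 * τ + ℕtoℚ 3                 ∎
    where open ≤-Reasoning

  leftover-middle : ∀ {τ} u a b → ℕtoℚ u < τ + τ → ℕtoℚ a < τ → ℕtoℚ b < τ →
                    ℕtoℚ (2 ℕ.* (u ℕ.+ (a ℕ.+ b))) ≤ ℕtoℚ 8 * τ + ℕtoℚ 3
  leftover-middle {τ} u a b u<2τ a<τ b<τ = begin
    ℕtoℚ (2 ℕ.* (u ℕ.+ (a ℕ.+ b)))             ≡⟨ trans (ℕtoℚ-* 2 (u ℕ.+ (a ℕ.+ b))) (cong (ℕtoℚ 2 *_)
                                                      (trans (ℕtoℚ-+ u (a ℕ.+ b)) (cong (_+_ (ℕtoℚ u)) (ℕtoℚ-+ a b)))) ⟩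
    ℕtoℚ 2 * (ℕtoℚ u + (ℕtoℚ a + ℕtoℚ b))      ≤⟨ *-monoˡ-≤-nonNeg (ℕtoℚ 2) {{ℕtoℚ-nonNeg 2}}
                                                      (+-mono-≤ (<⇒≤ u<2τ) (+-mono-≤ (<⇒≤ a<τ) (<⇒≤ b<τ))) ⟩
    ℕtoℚ 2 * ((τ + τ) + (τ + τ))               ≡⟨ two-quadruples τ ⟩
    ℕtoℚ 8 * τ                                 ≡⟨ +-identityʳ (ℕtoℚ 8 * τ) ⟨
    ℕtoℚ 8 * τ + 0ℚ                            ≤⟨ +-monoʳ-≤ (ℕtoℚ 8 * τ) (ℕtoℚ-mono-≤ {0} {3} z≤n) ⟩
    ℕtoℚ 8 * τ + ℕtoℚ 3                        ∎
    where open ≤-Reasoning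

  fraction-≤1 : ∀ {e k} → e ℕ.≤ suc k → + e / suc k ≤ 1ℚ
  fraction-≤1 {e} {k} e≤ = toℚᵘ-cancel-≤ (ℚᵘ.≤-respˡ-≃ (ℚᵘ.≃-sym (toℚᵘ-fromℚᵘ (ℚᵘ.mkℚᵘ (+ e) k)))
    (ℚᵘ.*≤* (subst₂ ℤ._≤_ (sym (ℤ.*-identityʳ (+ e))) (sym (ℤ.*-identityˡ (+ suc k))) (ℤ.+≤+ e≤))))

  fraction-zero : ∀ k → + 0 / suc k ≡ 0ℚ
  fraction-zero k = toℚᵘ-injective (ℚᵘ.≃-trans (toℚᵘ-fromℚᵘ (ℚᵘ.mkℚᵘ (+ 0) k)) (ℚᵘ.*≡* refl))

  fraction-nonNeg : ∀ e k → 0ℚ ≤ + e / suc k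
  fraction-nonNeg e k = nonNegative⁻¹ _ {{normalize-nonNeg e (suc k)}}

  0<-difference : ∀ {p q} → p < q → 0ℚ < q - p
  0<-difference {p} {q} p<q = subst (_< q - p) (+-inverseʳ p) (+-monoˡ-< (- p) p<q)

  twice : ∀ p → ℕtoℚ 2 * p ≡ p + p
  twice = +-*-Solver.solve 1 (λ p → con (ℕtoℚ 2) :* p := p :+ p) refl
    where open +-*-Solver

  ℕtoℚ-double : ∀ p k → p * ℕtoℚ (2 ℕ.* k) ≡ p * ℕtoℚ k + p * ℕtoℚ k
  ℕtoℚ-double p k = trans (cong (p *_) (ℕtoℚ-* 2 k))
    (+-*-Solver.solve 2 (λ p k → p :* (con (ℕtoℚ 2) :* k) := p :* k :+ p :* k) refl p (ℕtoℚ k))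
    where open +-*-Solver

  ℕtoℚ-positive : ∀ {k} → 0 ℕ.< k → 0ℚ < ℕtoℚ k
  ℕtoℚ-positive {suc k} _ = <-≤-trans (positive⁻¹ 1ℚ) (ℕtoℚ-mono-≤ {1} {suc k} (s≤s z≤n))

  *-pos : ∀ {p q} → 0ℚ < p → 0ℚ < q → 0ℚ < p * q
  *-pos {p} {q} 0<p 0<q = positive⁻¹ (p * q) {{pos*pos⇒pos p {{positive 0<p}} q {{positive 0<q}}}}

  half-below : ∀ {ε d} → 0ℚ < ε → ℕtoℚ 2 * ε < d → ε < d
  half-below {ε} 0<ε 2ε<d =
    <-trans (subst (_< ε + ε) (+-identityʳ ε) (+-monoʳ-< ε 0<ε)) (subst (_< _) (twice ε) 2ε<d)

  bounded-below⇒positive : ∀ {q k} → 0ℚ < q → q ≤ ℕtoℚ k → 0 ℕ.< k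
  bounded-below⇒positive {k = zero}  0<q q≤0 = contradiction (<-≤-trans 0<q q≤0) (<-irrefl refl)
  bounded-below⇒positive {k = suc _} _   _   = s≤s z≤n

module Counting where
  open import Data.Nat using (ℕ; zero; suc; _+_; _<_)
  open import Data.Nat.Properties using (+-identityʳ; +-commutativeSemigroup)
  open import Algebra.Properties.CommutativeSemigroup +-commutativeSemigroup using (interchange)
  open import Data.Nat.ListAction using (sum)
  open import Data.List using ([]; _∷_; allFin; filter; length)
  open import Data.List.Properties using (map-tabulate; map-cong)
  open import Data.List.Membership.Propositional using (_∈_)
  open import Data.List.Relation.Unary.Any using (here; there)
  import Data.List.Relation.Unary.All as All
  open import Data.List.Relation.Unary.AllPairs using (_∷_)
  open import Data.List.Relation.Unary.Unique.Propositional using (Unique)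
  open import Data.Fin.Properties using (_≟_)
  import Data.List.Membership.DecPropositional as DecMembership
  open import Function using (id)

  infix 4 _∈?_
  _∈?_ : ∀ {n} (x : Fin n) xs → Dec (x ∈ xs)
  _∈?_ = DecMembership._∈?_ _≟_

  indicator : Bool → ℕ
  indicator b = if b then 1 else 0

  count-suc : ∀ {n} (p : Fin (suc n) → Bool) → count p ≡ indicator (p zero) + count (p ∘ suc)
  count-suc p = cong (λ xs → indicator (p zero) + sum xs)
    (trans (map-tabulate suc (indicator ∘ p)) (sym (map-tabulate id (indicator ∘ p ∘ suc))))

  count-cong : ∀ {n} {p q : Fin n → Bool} → (∀ x → p x ≡ q x) → count p ≡ count q
  count-cong {n} p≗q = cong sum (map-cong (cong indicator ∘ p≗q) (allFin n))

  count-false : ∀ n → count {n} (λ _ → false) ≡ 0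
  count-false zero    = refl
  count-false (suc n) = trans (count-suc {n} (λ _ → false)) (count-false n)

  count-true : ∀ n → count {n} (λ _ → true) ≡ n
  count-true zero    = refl
  count-true (suc n) = trans (count-suc {n} (λ _ → true)) (cong suc (count-true n))

  count-split : ∀ {n} (p q : Fin n → Bool) →
                count p ≡ count (λ x → p x ∧ q x) + count (λ x → p x ∧ not (q x))
  count-split {zero}  p q = refl
  count-split {suc n} p q = begin
    count p                                              ≡⟨ count-suc p ⟩
    indicator (p zero) + count (p ∘ suc)                 ≡⟨ cong₂ _+_ (split-indicator (p zero) (q zero))
                                                                       (count-split (p ∘ suc) (q ∘ suc)) ⟩
    (indicator (p zero ∧ q zero) + indicator (p zero ∧ not (q zero))) +
    (count (λ x → p (suc x) ∧ q (suc x)) + count (λ x → p (suc x) ∧ not (q (suc x))))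
                                                         ≡⟨ interchange (indicator (p zero ∧ q zero)) (indicator (p zero ∧ not (q zero))) _ _ ⟩
    (indicator (p zero ∧ q zero) + count (λ x → p (suc x) ∧ q (suc x))) +
    (indicator (p zero ∧ not (q zero)) + count (λ x → p (suc x) ∧ not (q (suc x))))
                                                         ≡⟨ cong₂ _+_ (count-suc (λ x → p x ∧ q x)) (count-suc (λ x → p x ∧ not (q x))) ⟨
    count (λ x → p x ∧ q x) + count (λ x → p x ∧ not (q x)) ∎
    where
    open ≡-Reasoning
    split-indicator : ∀ a b → indicator a ≡ indicator (a ∧ b) + indicator (a ∧ not b)
    split-indicator false _     = refl
    split-indicator true  false = refl
    split-indicator true  true  = refl

  count-witness : ∀ {n} (p : Fin n → Bool) → 0 < count p → ∃[ x ] p x ≡ true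
  count-witness {suc n} p pos with p zero in p0 | count-suc p
  ... | true  | _         = zero , p0
  ... | false | count-p≡ =
    let x , px = count-witness (p ∘ suc) (subst (0 <_) count-p≡ pos) in suc x , px

  ∣_∣ : ∀ {n} {P : Fin n → Set} → Decidable P → ℕ
  ∣ P? ∣ = count (λ x → does (P? x))

  module _ {n} {P Q : Fin n → Set} (P? : Decidable P) (Q? : Decidable Q) where

    ∣∣-cong : (∀ x → P x ⇔ Q x) → ∣ P? ∣ ≡ ∣ Q? ∣
    ∣∣-cong P⇔Q = count-cong λ x → does-≡ (P? x) (map′ (Equivalence.from (P⇔Q x)) (Equivalence.to (P⇔Q x)) (Q? x))

    ∣∣-split : ∣ P? ∣ ≡ ∣ (λ x → P? x ×-dec Q? x) ∣ + ∣ (λ x → P? x ×-dec ¬? (Q? x)) ∣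
    ∣∣-split = count-split (λ x → does (P? x)) (λ x → does (Q? x))

  does-true : ∀ {A : Set} (a? : Dec A) → does a? ≡ true → A
  does-true (yes a) _ = a

  ∣∣-witness : ∀ {n} {P : Fin n → Set} (P? : Decidable P) → 0 < ∣ P? ∣ → ∃ P
  ∣∣-witness P? pos = let x , px = count-witness _ pos in x , does-true (P? x) px

  ∣singleton∣ : ∀ {n} {Q : Fin n → Set} (Q? : Decidable Q) a → ∣ (λ x → x ≟ a ×-dec Q? x) ∣ ≡ indicator (does (Q? a))
  ∣singleton∣ {suc n} Q? zero    = trans (count-suc (λ x → does (x ≟ zero ×-dec Q? x)))
                             (trans (cong (indicator (does (Q? zero)) +_) (count-false n)) (+-identityʳ _))
  ∣singleton∣ {suc n} Q? (suc a) = trans (count-suc (λ x → does (x ≟ suc a ×-dec Q? x))) (∣singleton∣ (Q? ∘ suc) a)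

  length-filter-∷ : ∀ {A : Set} {Q : A → Set} (Q? : Decidable Q) a xs →
                    length (filter Q? (a ∷ xs)) ≡ indicator (does (Q? a)) + length (filter Q? xs)
  length-filter-∷ Q? a xs with Q? a
  ... | yes _ = refl
  ... | no  _ = refl

  ∣∈∣-unique : ∀ {n} {Q : Fin n → Set} (Q? : Decidable Q) {xs} → Unique xs →
               ∣ (λ x → x ∈? xs ×-dec Q? x) ∣ ≡ length (filter Q? xs)
  ∣∈∣-unique {n} Q? {[]}     _              = count-false n
  ∣∈∣-unique {Q = Q} Q? {a ∷ xs} (a∉xs ∷ xs!) = begin
    ∣ in-a∷xs ∣                           ≡⟨ ∣∣-split in-a∷xs (_≟ a) ⟩
    ∣ at-a? ∣ + ∣ off-a? ∣                ≡⟨ cong₂ _+_ (∣∣-cong at-a? (λ x → x ≟ a ×-dec Q? x) λ _ → mk⇔ at-a from-a)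
                                                      (∣∣-cong off-a? (λ x → x ∈? xs ×-dec Q? x) λ _ → mk⇔ off-a to-off-a) ⟩
    ∣ (λ x → x ≟ a ×-dec Q? x) ∣ + ∣ (λ x → x ∈? xs ×-dec Q? x) ∣
                                          ≡⟨ cong₂ _+_ (∣singleton∣ Q? a) (∣∈∣-unique Q? xs!) ⟩
    indicator (does (Q? a)) + length (filter Q? xs)
                                          ≡⟨ length-filter-∷ Q? a xs ⟨
    length (filter Q? (a ∷ xs))           ∎
    where
    open ≡-Reasoning
    in-a∷xs : Decidable (λ x → x ∈ a ∷ xs × Q x)
    in-a∷xs x = x ∈? a ∷ xs ×-dec Q? x
    at-a? : Decidable (λ x → (x ∈ a ∷ xs × Q x) × x ≡ a)
    at-a? x = in-a∷xs x ×-dec x ≟ a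
    off-a? : Decidable (λ x → (x ∈ a ∷ xs × Q x) × ¬ x ≡ a)
    off-a? x = in-a∷xs x ×-dec ¬? (x ≟ a)
    at-a : ∀ {x} → (x ∈ a ∷ xs × Q x) × x ≡ a → x ≡ a × Q x
    at-a ((_ , qx) , refl) = refl , qx
    from-a : ∀ {x} → x ≡ a × Q x → (x ∈ a ∷ xs × Q x) × x ≡ a
    from-a (refl , qx) = (here refl , qx) , refl
    off-a : ∀ {x} → (x ∈ a ∷ xs × Q x) × ¬ x ≡ a → x ∈ xs × Q x
    off-a ((here x≡a , _)  , x≢a) = contradiction x≡a x≢a
    off-a ((there x∈xs , qx) , _) = x∈xs , qx
    to-off-a : ∀ {x} → x ∈ xs × Q x → (x ∈ a ∷ xs × Q x) × ¬ x ≡ a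
    to-off-a (x∈xs , qx) = (there x∈xs , qx) , λ x≡a → All.lookup a∉xs x∈xs (sym x≡a)

module UniqueLists where
  open import Data.Nat using (_≤_)
  open import Data.List using (List; []; _∷_; _++_; length; lookup)
  open import Data.List.Membership.Propositional.Properties using (∈-lookup)
  import Data.List.Relation.Unary.All as All
  import Data.List.Relation.Unary.All.Properties as All
  open import Data.List.Relation.Unary.AllPairs using ([]; _∷_)
  open import Data.List.Relation.Unary.Unique.Propositional using (Unique)
  open import Data.Fin.Properties using (injective⇒≤)

  lookup-injective : ∀ {A : Set} {xs : List A} → Unique xs → ∀ {i j} → lookup xs i ≡ lookup xs j → i ≡ j
  lookup-injective (_   ∷ _) {zero}  {zero}  _  = refl
  lookup-injective (x∉ ∷ _) {zero}  {suc j} eq = contradiction eq (All.lookup x∉ (∈-lookup j))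
  lookup-injective (x∉ ∷ _) {suc i} {zero}  eq = contradiction (sym eq) (All.lookup x∉ (∈-lookup i))
  lookup-injective (_  ∷ u) {suc i} {suc j} eq = cong suc (lookup-injective u eq)

  unique-length : ∀ {n} {xs : List (Fin n)} → Unique xs → length xs ≤ n
  unique-length u = injective⇒≤ (lookup-injective u)

  unique-++ˡ : ∀ {A : Set} (xs : List A) {ys} → Unique (xs ++ ys) → Unique xs
  unique-++ˡ []       _        = []
  unique-++ˡ (x ∷ xs) (x∉ ∷ u) = All.++⁻ˡ xs x∉ ∷ unique-++ˡ xs u

  unique-++ʳ : ∀ {A : Set} (xs : List A) {ys} → Unique (xs ++ ys) → Unique ys
  unique-++ʳ []       u       = u
  unique-++ʳ (x ∷ xs) (_ ∷ u) = unique-++ʳ xs u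

module Tripartite where
  open import Data.Rational using (ℚ; _≤_; _+_)
  open import Data.Rational.Properties using (_≤?_)
  open import Relation.Binary.Definitions using (DecidableEquality)
  open Counting using (∣_∣)

  data End : Set where
    left right : End

  opposite : End → End
  opposite left  = right
  opposite right = left

  opposite-involutive : ∀ s → opposite (opposite s) ≡ s
  opposite-involutive left  = refl
  opposite-involutive right = refl

  opposite-cases : ∀ s t → t ≡ s ⊎ t ≡ opposite s
  opposite-cases left  left  = inj₁ refl
  opposite-cases left  right = inj₂ refl
  opposite-cases right left  = inj₂ refl
  opposite-cases right right = inj₁ refl

  data Part : Set where
    outer  : End → Part
    middle : Part

  outer-injective : ∀ {s t} → outer s ≡ outer t → s ≡ t
  outer-injective refl = refl

  outer-opposite-≢ : ∀ s → outer (opposite s) ≢ outer s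
  outer-opposite-≢ left  ()
  outer-opposite-≢ right ()

  infix 4 _≟ₚ_
  _≟ₚ_ : DecidableEquality Part
  outer left  ≟ₚ outer left  = yes refl
  outer left  ≟ₚ outer right = no λ ()
  outer right ≟ₚ outer left  = no λ ()
  outer right ≟ₚ outer right = yes refl
  outer _     ≟ₚ middle      = no λ ()
  middle      ≟ₚ outer _     = no λ ()
  middle      ≟ₚ middle      = yes refl

  all-or-some : ∀ {P : Part → Set} → Dec (P (outer left)) → Dec (P middle) → Dec (P (outer right)) →
                (∀ c → P c) ⊎ ∃[ c ] ¬ P c
  all-or-some (no ¬p)  _        _        = inj₂ (outer left , ¬p)
  all-or-some (yes _)  (no ¬p)  _        = inj₂ (middle , ¬p)
  all-or-some (yes _)  (yes _)  (no ¬p)  = inj₂ (outer right , ¬p)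
  all-or-some (yes pl) (yes pm) (yes pr) = inj₁ λ where
    (outer left)  → pl
    middle        → pm
    (outer right) → pr

  module _ {n} (part : Fin n → Part) where

    InPart : Part → Fin n → Set
    InPart c x = part x ≡ c

    inPart? : ∀ c → Decidable (InPart c)
    inPart? c x = part x ≟ₚ c

  -- τ stands for ε m, the middle part being twice as large as the outer ones.
  threshold : ℚ → Part → ℚ
  threshold τ (outer _) = τ
  threshold τ middle    = τ + τ

  Large : ∀ {n} → ℚ → Part → {P : Fin n → Set} → Decidable P → Set
  Large τ c P? = threshold τ c ≤ ℕtoℚ ∣ P? ∣

  large? : ∀ {n} τ c {P : Fin n → Set} (P? : Decidable P) → Dec (Large τ c P?)
  large? τ c P? = threshold τ c ≤? ℕtoℚ ∣ P? ∣

  module _ {n} (H : ThreeGraph n) where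

    edge-reverse : ∀ {x y z} → edge H x y z ≡ true → edge H z y x ≡ true
    edge-reverse {x} {y} {z} e = trans (sym₁₂ H z y x) (trans (sym₂₃ H y z x) (trans (sym₁₂ H y x z) e))

    SpansEdge : (A B C : Fin n → Set) → Set
    SpansEdge A B C = ∃[ x ] ∃[ y ] ∃[ z ] A x × B y × C z × edge H x y z ≡ true

    LargeTriplesSpanEdges : (Fin n → Part) → ℚ → Set₁
    LargeTriplesSpanEdges part τ =
      ∀ {A B C} (A? : Decidable A) (B? : Decidable B) (C? : Decidable C) →
      (∀ {x} → A x → part x ≡ outer left) → (∀ {y} → B y → part y ≡ middle) → (∀ {z} → C z → part z ≡ outer right) →
      Large τ (outer left) A? → Large τ middle B? → Large τ (outer right) C? → SpansEdge A B C

open Tripartite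

module LoosePathSearch
  {n : ℕ} (H : ThreeGraph n) (part : Fin n → Part)
  {τ : ℚ.ℚ} (τ-pos : ℚ.0ℚ ℚ.< τ) {m : ℕ} (m-pos : 0 ℕ.< m)
  (outer-size : ∀ s → Counting.∣ inPart? part (outer s) ∣ ≡ m)
  (middle-size : Counting.∣ inPart? part middle ∣ ≡ 2 ℕ.* m)
  (dense : LargeTriplesSpanEdges H part τ)
  where

  open import Data.Nat using (zero; suc; _+_; _*_; _≤_; _<_; _∸_; z≤n; s≤s; s<s⁻¹)
  open import Data.Nat.Properties
    using (≤-trans; ≤-reflexive; <-irrefl; ≰⇒>; <⇒≱; n≤1+n; n<1+n; m<n⇒m<1+n; m≤n+m; m≤n*m; +-comm; +-identityʳ; +-suc;
           +-monoˡ-≤; +-monoʳ-≤; *-suc; *-distribˡ-+; *-monoʳ-≤; m≤n+o⇒m∸n≤o; module ≤-Reasoning)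
  open import Data.Nat.Tactic.RingSolver using (solve-∀)
  open ℚ using (ℚ; 0ℚ)
  import Data.Rational.Properties as ℚₚ
  open import Data.List using (List; []; _∷_; _++_; length; lookup; filter)
  open import Data.List.Properties using (length-++; filter-++; filter-accept; filter-reject)
  open import Data.List.Membership.Propositional using (_∈_; _∉_)
  open import Data.List.Relation.Binary.Subset.Propositional using (_⊆_)
  open import Data.List.Relation.Unary.Any using (here; there)
  open import Data.List.Relation.Unary.All.Properties using (¬Any⇒All¬)
  open import Data.List.Relation.Unary.All using ([]; _∷_)
  open import Data.List.Relation.Unary.AllPairs using ([]; _∷_)
  open import Data.List.Relation.Unary.Unique.Propositional using (Unique)
  open import Data.List.Relation.Binary.Permutation.Setoid (setoid (Fin n)) using (_↭_)
  open import Data.List.Relation.Binary.Permutation.Setoid.Properties (setoid (Fin n))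
    using (Unique-resp-↭; ∈-resp-↭; shifts)
  open import Data.Fin using (toℕ; fromℕ<; cast)
  open import Data.Fin.Properties using (any?; toℕ-injective; toℕ-cast; toℕ-fromℕ<)
  import Data.Bool.Properties as Bool
  open import Function.Definitions using (Injective)
  open Counting
  open Rationals using (ℕtoℚ-mono-≤; leftover-outer; leftover-middle)
  open UniqueLists

  Unvisited : List (Fin n) → Part → Fin n → Set
  Unvisited visited c x = part x ≡ c × x ∉ visited

  unvisited? : ∀ visited c → Decidable (Unvisited visited c)
  unvisited? visited c x = part x ≟ₚ c ×-dec ¬? (x ∈? visited)

  Among : List (Fin n) → Part → Fin n → Set
  Among xs c x = x ∈ xs × part x ≡ c

  among? : ∀ xs c → Decidable (Among xs c)
  among? xs c x = x ∈? xs ×-dec part x ≟ₚ c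

  occurrences : Part → List (Fin n) → ℕ
  occurrences c xs = length (filter (inPart? part c) xs)

  ∣among∣ : ∀ {xs} → Unique xs → ∀ c → ∣ among? xs c ∣ ≡ occurrences c xs
  ∣among∣ u c = ∣∈∣-unique (inPart? part c) u

  part-≢ : ∀ {x c c′} → part x ≡ c → c ≢ c′ → part x ≢ c′
  part-≢ px c≢c′ px′ = c≢c′ (trans (sym px) px′)

  spans-edge : ∀ s {A B C} (A? : Decidable A) (B? : Decidable B) (C? : Decidable C) →
               (∀ {x} → A x → part x ≡ outer s) → (∀ {y} → B y → part y ≡ middle) →
               (∀ {z} → C z → part z ≡ outer (opposite s)) →
               Large τ (outer s) A? → Large τ middle B? → Large τ (outer (opposite s)) C? → SpansEdge H A B C
  spans-edge left  = dense
  spans-edge right A? B? C? A⊆ B⊆ C⊆ large-A large-B large-C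
    with z , y , x , z∈C , y∈B , x∈A , e ← dense C? B? A? C⊆ B⊆ A⊆ large-C large-B large-A
    = x , y , z , x∈A , y∈B , z∈C , edge-reverse H e

  Extension : List (Fin n) → End → Fin n → Set
  Extension visited s x =
    ∃[ y ] ∃[ z ] Unvisited visited middle y × Unvisited visited (outer s) z × edge H x y z ≡ true

  extension? : ∀ visited s x → Dec (Extension visited s x)
  extension? visited s x = any? λ y → any? λ z →
    unvisited? visited middle y ×-dec unvisited? visited (outer s) z ×-dec edge H x y z Bool.≟ true

  extension-antitone : ∀ {visited visited′ s x} → visited ⊆ visited′ → Extension visited′ s x → Extension visited s x
  extension-antitone ⊆′ (y , z , (py , y∉) , (pz , z∉) , e) = y , z , (py , y∉ ∘ ⊆′) , (pz , z∉ ∘ ⊆′) , e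

  Exhausted : List (Fin n) → List (Fin n) → Set
  Exhausted visited dead = ∀ {s x} → x ∈ dead → part x ≡ outer s → ¬ Extension visited (opposite s) x

  exhausted-mono : ∀ {visited visited′ dead} → visited ⊆ visited′ → Exhausted visited dead → Exhausted visited′ dead
  exhausted-mono ⊆′ exhausted x∈ px = exhausted x∈ px ∘ extension-antitone ⊆′

  exhausted-∷-outer : ∀ {visited dead s x} → part x ≡ outer s → ¬ Extension visited (opposite s) x →
                      Exhausted visited dead → Exhausted visited (x ∷ dead)
  exhausted-∷-outer {visited} {x = x} px stuck _ (here refl) px′ =
    subst (λ t → ¬ Extension visited (opposite t) x) (outer-injective (trans (sym px) px′)) stuck
  exhausted-∷-outer px stuck exhausted (there x∈) = exhausted x∈

  exhausted-∷-middle : ∀ {visited dead y} → part y ≡ middle → Exhausted visited dead → Exhausted visited (y ∷ dead)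
  exhausted-∷-middle py _ (here refl) py′ = contradiction py′ (part-≢ py λ ())
  exhausted-∷-middle py exhausted (there y∈) = exhausted y∈

  exhausted⇒small : ∀ {visited dead} → Exhausted visited dead → ∀ s →
                    Large τ middle (unvisited? visited middle) →
                    Large τ (outer (opposite s)) (unvisited? visited (outer (opposite s))) →
                    ¬ Large τ (outer s) (among? dead (outer s))
  exhausted⇒small {visited} {dead} exhausted s large-middle large-opposite large-dead
    with x , y , z , (x∈ , px) , y∈ , z∈ , e ←
           spans-edge s (among? dead (outer s)) (unvisited? visited middle) (unvisited? visited (outer (opposite s)))
                      proj₂ proj₁ proj₁ large-dead large-middle large-opposite
    = exhausted x∈ px (y , z , y∈ , z∈ , e)

  occurrences-here : ∀ {c x} xs → part x ≡ c → occurrences c (x ∷ xs) ≡ suc (occurrences c xs)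
  occurrences-here {c} _ px = cong length (filter-accept (inPart? part c) px)

  occurrences-not-here : ∀ {c x} xs → part x ≢ c → occurrences c (x ∷ xs) ≡ occurrences c xs
  occurrences-not-here {c} _ px = cong length (filter-reject (inPart? part c) px)

  data Balanced : List (Fin n) → Set where
    []     : Balanced []
    single : ∀ {s x xs} → part x ≡ outer s → Balanced xs → Balanced (x ∷ xs)
    pair   : ∀ {s x y xs} → part x ≡ outer s → part y ≡ middle → Balanced xs → Balanced (x ∷ y ∷ xs)

  outer-occurrences : List (Fin n) → ℕ
  outer-occurrences xs = occurrences (outer left) xs + occurrences (outer right) xs

  outer-occurrences-outer : ∀ {s x} xs → part x ≡ outer s → outer-occurrences (x ∷ xs) ≡ suc (outer-occurrences xs)
  outer-occurrences-outer {left} xs px =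
    cong₂ _+_ (occurrences-here xs px) (occurrences-not-here xs (part-≢ px λ ()))
  outer-occurrences-outer {right} xs px =
    trans (cong₂ _+_ (occurrences-not-here xs (part-≢ px λ ())) (occurrences-here xs px))
          (+-suc _ _)

  outer-occurrences-middle : ∀ {y} xs → part y ≡ middle → outer-occurrences (y ∷ xs) ≡ outer-occurrences xs
  outer-occurrences-middle xs py =
    cong₂ _+_ (occurrences-not-here xs (part-≢ py λ ())) (occurrences-not-here xs (part-≢ py λ ()))

  balanced-middle : ∀ {xs} → Balanced xs → occurrences middle xs ≤ outer-occurrences xs
  balanced-middle [] = z≤n
  balanced-middle {x ∷ xs} (single px balanced) = begin
    occurrences middle (x ∷ xs) ≡⟨ occurrences-not-here xs (part-≢ px λ ()) ⟩
    occurrences middle xs       ≤⟨ balanced-middle balanced ⟩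
    outer-occurrences xs        ≤⟨ n≤1+n _ ⟩
    suc (outer-occurrences xs)  ≡⟨ outer-occurrences-outer xs px ⟨
    outer-occurrences (x ∷ xs)  ∎
    where open ≤-Reasoning
  balanced-middle {x ∷ y ∷ xs} (pair px py balanced) = begin
    occurrences middle (x ∷ y ∷ xs)  ≡⟨ occurrences-not-here (y ∷ xs) (part-≢ px λ ()) ⟩
    occurrences middle (y ∷ xs)      ≡⟨ occurrences-here xs py ⟩
    suc (occurrences middle xs)      ≤⟨ s≤s (balanced-middle balanced) ⟩
    suc (outer-occurrences xs)       ≡⟨ cong suc (outer-occurrences-middle xs py) ⟨
    suc (outer-occurrences (y ∷ xs)) ≡⟨ outer-occurrences-outer (y ∷ xs) px ⟨
    outer-occurrences (x ∷ y ∷ xs)   ∎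
    where open ≤-Reasoning

  -- Chain s x xs j: the loose path x ∷ xs with j edges, listed from its free end x, which lies in outer s.
  data Chain : End → Fin n → List (Fin n) → ℕ → Set where
    start  : ∀ {x} → part x ≡ outer left → Chain left x [] 0
    extend : ∀ {s j x xs y z} → Chain s x xs j → part y ≡ middle → part z ≡ outer (opposite s) →
             edge H z y x ≡ true → Chain (opposite s) z (y ∷ x ∷ xs) (suc j)

  chain-length : ∀ {s x xs j} → Chain s x xs j → length xs ≡ 2 * j
  chain-length (start _)                   = refl
  chain-length {j = suc j} (extend ch _ _ _) = trans (cong (λ k → suc (suc k)) (chain-length ch)) (sym (*-suc 2 j))

  chain-middle : ∀ {s x xs j} → Chain s x xs j → occurrences middle (x ∷ xs) ≡ j
  chain-middle (start px) = occurrences-not-here [] (part-≢ px λ ())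
  chain-middle {x = z} (extend {x = x} {xs} {y} ch py pz _) = begin
    occurrences middle (z ∷ y ∷ x ∷ xs) ≡⟨ occurrences-not-here (y ∷ x ∷ xs) (part-≢ pz λ ()) ⟩
    occurrences middle (y ∷ x ∷ xs)     ≡⟨ occurrences-here (x ∷ xs) py ⟩
    suc (occurrences middle (x ∷ xs))   ≡⟨ cong suc (chain-middle ch) ⟩
    suc _                               ∎
    where open ≡-Reasoning

  chain-ends : ∀ {s x xs j} → Chain s x xs j →
               2 * occurrences (outer s) (x ∷ xs) ≤ 2 + j × 2 * occurrences (outer (opposite s)) (x ∷ xs) ≤ 1 + j
  chain-ends (start px) =
    ≤-reflexive (cong (2 *_) (occurrences-here [] px)) ,
    ≤-trans (≤-reflexive (cong (2 *_) (occurrences-not-here [] (part-≢ px λ ())))) z≤n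
  chain-ends {x = z} (extend {s} {j} {x} {xs} {y} ch py pz _) = free-end , other-end
    where
    free-end : 2 * occurrences (outer (opposite s)) (z ∷ y ∷ x ∷ xs) ≤ 2 + suc j
    free-end = begin
      2 * occurrences (outer (opposite s)) (z ∷ y ∷ x ∷ xs)   ≡⟨ cong (2 *_) (occurrences-here (y ∷ x ∷ xs) pz) ⟩
      2 * suc (occurrences (outer (opposite s)) (y ∷ x ∷ xs)) ≡⟨ cong (λ k → 2 * suc k) (occurrences-not-here (x ∷ xs) (part-≢ py λ ())) ⟩
      2 * suc (occurrences (outer (opposite s)) (x ∷ xs))     ≡⟨ *-suc 2 _ ⟩
      2 + 2 * occurrences (outer (opposite s)) (x ∷ xs)       ≤⟨ +-monoʳ-≤ 2 (proj₂ (chain-ends ch)) ⟩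
      2 + suc j                                               ∎
      where open ≤-Reasoning
    other-end : 2 * occurrences (outer (opposite (opposite s))) (z ∷ y ∷ x ∷ xs) ≤ 1 + suc j
    other-end = subst (λ t → 2 * occurrences (outer t) (z ∷ y ∷ x ∷ xs) ≤ 1 + suc j) (sym (opposite-involutive s)) (begin
      2 * occurrences (outer s) (z ∷ y ∷ x ∷ xs) ≡⟨ cong (2 *_) (occurrences-not-here (y ∷ x ∷ xs)
                                                      (part-≢ pz (outer-opposite-≢ s))) ⟩
      2 * occurrences (outer s) (y ∷ x ∷ xs)     ≡⟨ cong (2 *_) (occurrences-not-here (x ∷ xs) (part-≢ py λ ())) ⟩
      2 * occurrences (outer s) (x ∷ xs)         ≤⟨ proj₁ (chain-ends ch) ⟩
      1 + suc j                                  ∎)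
      where open ≤-Reasoning

  chain-outer : ∀ {s x xs j} → Chain s x xs j → ∀ t → 2 * occurrences (outer t) (x ∷ xs) ≤ 2 + j
  chain-outer {s} ch t with chain-ends ch | opposite-cases s t
  ... | free-end , _         | inj₁ refl = free-end
  ... | _        , other-end | inj₂ refl = ≤-trans other-end (n≤1+n _)

  chain-edge : ∀ {s x xs j} → Chain s x xs j → ∀ i → i < j →
               (p : 2 * i < length (x ∷ xs)) (q : suc (2 * i) < length (x ∷ xs)) (r : 2 + 2 * i < length (x ∷ xs)) →
               edge H (lookup (x ∷ xs) (fromℕ< p)) (lookup (x ∷ xs) (fromℕ< q)) (lookup (x ∷ xs) (fromℕ< r)) ≡ true
  chain-edge (extend _  _ _ e) zero    _         _ _ _ = e
  chain-edge (extend ch _ _ _) (suc i) (s≤s i<j) rewrite +-suc i (i + 0) = λ p q r →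
    chain-edge ch i i<j (s<s⁻¹ (s<s⁻¹ p)) (s<s⁻¹ (s<s⁻¹ q)) (s<s⁻¹ (s<s⁻¹ r))

  loose-path : ∀ {s x xs j} → Chain s x xs j → Unique (x ∷ xs) → LoosePath H j
  loose-path {x = x} {xs} {j} ch distinct =
    record { vtx = vertex ; injective = vertex-injective ; edges = vertex-edges }
    where
    length≡ : suc (2 * j) ≡ length (x ∷ xs)
    length≡ = cong suc (sym (chain-length ch))

    vertex : Fin (suc (2 * j)) → Fin n
    vertex i = lookup (x ∷ xs) (cast length≡ i)

    vertex-injective : Injective _≡_ _≡_ vertex
    vertex-injective {i} {i′} eq = toℕ-injective (begin
      toℕ i                 ≡⟨ toℕ-cast length≡ i ⟨
      toℕ (cast length≡ i)  ≡⟨ cong toℕ (lookup-injective distinct eq) ⟩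
      toℕ (cast length≡ i′) ≡⟨ toℕ-cast length≡ i′ ⟩
      toℕ i′                ∎)
      where open ≡-Reasoning

    vertex-at : ∀ {k} (p : k < suc (2 * j)) → vertex (fromℕ< p) ≡ lookup (x ∷ xs) (fromℕ< (subst (k <_) length≡ p))
    vertex-at {k} p = cong (lookup (x ∷ xs)) (toℕ-injective
      (trans (toℕ-cast length≡ (fromℕ< p)) (trans (toℕ-fromℕ< p) (sym (toℕ-fromℕ< (subst (k <_) length≡ p))))))

    vertex-edges : ∀ i → i < j → (p : 2 * i < suc (2 * j)) (q : suc (2 * i) < suc (2 * j)) (r : 2 + 2 * i < suc (2 * j)) →
                   edge H (vertex (fromℕ< p)) (vertex (fromℕ< q)) (vertex (fromℕ< r)) ≡ true
    vertex-edges i i<j p q r rewrite vertex-at p | vertex-at q | vertex-at r =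
      chain-edge ch i i<j (subst (2 * i <_) length≡ p) (subst (suc (2 * i) <_) length≡ q) (subst (2 + 2 * i <_) length≡ r)

  record State : Set where
    constructor state
    field
      end        : End
      edges      : ℕ
      head       : Fin n
      tail       : List (Fin n)
      dead       : List (Fin n)
      chain      : Chain end head tail edges
      distinct   : Unique (head ∷ tail ++ dead)
      balanced   : Balanced dead
      exhausted  : Exhausted (head ∷ tail ++ dead) dead
      dead-small : ∀ s → ¬ Large τ (outer s) (among? dead (outer s))

    visited : List (Fin n)
    visited = head ∷ tail ++ dead

    progress : ℕ
    progress = length (head ∷ tail) + 2 * length dead

  open State

  AllLarge : State → Set
  AllLarge S = ∀ c → Large τ c (unvisited? (visited S) c)

  Successor : State → Set
  Successor S = Σ State λ S′ → progress S < progress S′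

  large-nonempty : ∀ s {P : Fin n → Set} (P? : Decidable P) → Large τ (outer s) P? → 0 < ∣ P? ∣
  large-nonempty _ P? large = ≰⇒> λ ∣P∣≤0 →
    ℚₚ.<-irrefl refl (ℚₚ.<-≤-trans τ-pos (ℚₚ.≤-trans large (ℕtoℚ-mono-≤ {∣ P? ∣} {0} ∣P∣≤0)))

  push : ∀ S → Extension (visited S) (opposite (end S)) (head S) → Successor S
  push (state s j h t dead ch distinct balanced exhausted dead-small) (y , z , (py , y∉) , (pz , z∉) , e) =
    state (opposite s) (suc j) z (y ∷ h ∷ t) dead (extend ch py pz (edge-reverse H e))
          ((z≢y ∷ ¬Any⇒All¬ _ z∉) ∷ ¬Any⇒All¬ _ y∉ ∷ distinct) balanced
          (exhausted-mono (there ∘ there) exhausted) dead-small ,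
    m<n⇒m<1+n (n<1+n _)
    where
    z≢y : z ≢ y
    z≢y refl = part-≢ pz (λ ()) py

  retreat : ∀ S → ¬ Extension (visited S) (opposite (end S)) (head S) → AllLarge S → Successor S
  retreat S@(state .left .0 h .[] dead (start ph) distinct balanced exhausted _) stuck large =
    restart (∣∣-witness (unvisited? (h ∷ dead) (outer left))
                        (large-nonempty left (unvisited? (h ∷ dead) (outer left)) (large (outer left))))
    where
    buried : Exhausted (h ∷ dead) (h ∷ dead)
    buried = exhausted-∷-outer ph stuck exhausted
    restart-grows : ∀ d → 1 + 2 * d < 1 + 2 * suc d
    restart-grows d = s≤s (≤-trans (n≤1+n _) (≤-reflexive (sym (*-suc 2 d))))
    restart : ∃ (Unvisited (h ∷ dead) (outer left)) → Successor S
    restart (x₀ , px₀ , x₀∉) =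
      state left 0 x₀ [] (h ∷ dead) (start px₀) (¬Any⇒All¬ _ x₀∉ ∷ distinct) (single ph balanced)
            (exhausted-mono there buried) (λ s → exhausted⇒small buried s (large middle) (large (outer (opposite s)))) ,
      restart-grows (length dead)
  retreat (state .(opposite s) .(suc j) h .(y ∷ x ∷ t) dead (extend {s} {j} {x} {t} {y} ch py ph _)
                 distinct balanced exhausted _) stuck large
    = state s j x t (h ∷ y ∷ dead) ch (Unique-resp-↭ moved distinct) (pair ph py balanced)
            (exhausted-mono (∈-resp-↭ moved) buried)
            (λ s′ → exhausted⇒small buried s′ (large middle) (large (outer (opposite s′)))) ,
      pop-grows (length t) (length dead)
    where
    moved : h ∷ y ∷ x ∷ t ++ dead ↭ x ∷ t ++ h ∷ y ∷ dead
    moved = shifts (h ∷ y ∷ []) (x ∷ t)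
    buried : Exhausted (h ∷ y ∷ x ∷ t ++ dead) (h ∷ y ∷ dead)
    buried = exhausted-∷-outer ph stuck (exhausted-∷-middle py exhausted)
    pop-grows : ∀ a d → 3 + a + 2 * d < 1 + a + 2 * (2 + d)
    pop-grows a d = ≤-trans (n≤1+n _) (≤-reflexive (sym (regroup a d)))
      where
      regroup : ∀ a d → 1 + a + 2 * (2 + d) ≡ 2 + (3 + a + 2 * d)
      regroup = solve-∀

  step : ∀ S → AllLarge S → Successor S
  step S large = extend-or-retreat (extension? (visited S) (opposite (end S)) (head S))
    where
    extend-or-retreat : Dec (Extension (visited S) (opposite (end S)) (head S)) → Successor S
    extend-or-retreat (yes extension) = push S extension
    extend-or-retreat (no stuck)      = retreat S stuck large

  Final : State → Set
  Final S = ∃[ c ] ¬ Large τ c (unvisited? (visited S) c)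

  all-large? : ∀ S → AllLarge S ⊎ Final S
  all-large? S = all-or-some (large? τ (outer left) (U (outer left))) (large? τ middle (U middle))
                             (large? τ (outer right) (U (outer right)))
    where U = unvisited? (visited S)

  initial : State
  initial = start-at (∣∣-witness (inPart? part (outer left)) (subst (0 <_) (sym (outer-size left)) m-pos))
    where
    no-dead : ∀ s → ¬ Large τ (outer s) (among? [] (outer s))
    no-dead s large = <-irrefl (sym (count-false n)) (large-nonempty s (among? [] (outer s)) large)
    start-at : ∃ (InPart part (outer left)) → State
    start-at (x₀ , px₀) = state left 0 x₀ [] [] (start px₀) ([] ∷ []) [] (λ ()) no-dead

  progress-bound : ∀ S → progress S ≤ 2 * n
  progress-bound (state _ _ h t dead _ distinct _ _ _) = begin
    length (h ∷ t) + 2 * length dead               ≤⟨ +-monoˡ-≤ (2 * length dead) (m≤n*m (length (h ∷ t)) 2) ⟩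
    2 * length (h ∷ t) + 2 * length dead           ≡⟨ *-distribˡ-+ 2 (length (h ∷ t)) (length dead) ⟨
    2 * (length (h ∷ t) + length dead)             ≡⟨ cong (2 *_) (length-++ (h ∷ t)) ⟨
    2 * length (h ∷ t ++ dead)                     ≤⟨ *-monoʳ-≤ 2 (unique-length distinct) ⟩
    2 * n                                          ∎
    where open ≤-Reasoning

  -- Every step raises the progress, which never exceeds 2n, so 2n steps suffice.
  search : ∀ fuel S → 2 * n ≤ progress S + fuel → Σ State Final
  search fuel S bound = continue (all-large? S)
    where
    advance : ∀ fuel → Successor S → 2 * n ≤ progress S + fuel → Σ State Final
    advance zero       (S′ , grows) bound =
      contradiction (≤-trans (progress-bound S′) (≤-trans bound (≤-reflexive (+-identityʳ _)))) (<⇒≱ grows)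
    advance (suc fuel) (S′ , grows) bound =
      search fuel S′ (≤-trans bound (≤-trans (≤-reflexive (+-suc _ fuel)) (+-monoˡ-≤ fuel grows)))

    continue : AllLarge S ⊎ Final S → Σ State Final
    continue (inj₂ final) = S , final
    continue (inj₁ large) = advance fuel (step S large) bound

  occurrences-++ : ∀ c xs ys → occurrences c (xs ++ ys) ≡ occurrences c xs + occurrences c ys
  occurrences-++ c xs ys = trans (cong length (filter-++ (inPart? part c) xs ys)) (length-++ (filter (inPart? part c) xs))

  part-decomposition : ∀ xs ys → Unique (xs ++ ys) → ∀ c →
              ∣ inPart? part c ∣ ≡ ∣ unvisited? (xs ++ ys) c ∣ + (occurrences c xs + occurrences c ys)
  part-decomposition xs ys distinct c = begin
    ∣ inPart? part c ∣                                          ≡⟨ ∣∣-split (inPart? part c) (_∈? xs ++ ys) ⟩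
    ∣ visited-in-c ∣ + ∣ unvisited? (xs ++ ys) c ∣                ≡⟨ +-comm ∣ visited-in-c ∣ _ ⟩
    ∣ unvisited? (xs ++ ys) c ∣ + ∣ visited-in-c ∣                ≡⟨ cong (∣ unvisited? (xs ++ ys) c ∣ +_) (begin
        ∣ visited-in-c ∣                    ≡⟨ ∣∣-cong visited-in-c (among? (xs ++ ys) c) (λ _ → mk⇔ swap swap) ⟩
        ∣ among? (xs ++ ys) c ∣             ≡⟨ ∣among∣ distinct c ⟩
        occurrences c (xs ++ ys)            ≡⟨ occurrences-++ c xs ys ⟩
        occurrences c xs + occurrences c ys ∎) ⟩
    ∣ unvisited? (xs ++ ys) c ∣ + (occurrences c xs + occurrences c ys) ∎
    where
    open ≡-Reasoning
    visited-in-c : Decidable (λ x → part x ≡ c × x ∈ xs ++ ys)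
    visited-in-c x = part x ≟ₚ c ×-dec x ∈? xs ++ ys

  vertex-count : n ≡ 4 * m
  vertex-count = begin
    n                                                           ≡⟨ count-true n ⟨
    count {n} (λ _ → true)                                      ≡⟨ count-split (λ _ → true) (is middle) ⟩
    ∣ inPart? part middle ∣ + count (not ∘ is middle)          ≡⟨ cong (∣ inPart? part middle ∣ +_)
                                                                        (count-split (not ∘ is middle) (is (outer left))) ⟩
    ∣ inPart? part middle ∣ + (count (λ x → not (is middle x) ∧ is (outer left) x) +
                               count (λ x → not (is middle x) ∧ not (is (outer left) x)))
                                                                ≡⟨ cong (∣ inPart? part middle ∣ +_)
                                                                        (cong₂ _+_ (count-cong left-only) (count-cong right-only)) ⟩
    ∣ inPart? part middle ∣ + (∣ inPart? part (outer left) ∣ + ∣ inPart? part (outer right) ∣)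
                                                                ≡⟨ cong₂ _+_ middle-size (cong₂ _+_ (outer-size left) (outer-size right)) ⟩
    2 * m + (m + m)                                             ≡⟨ regroup m ⟩
    4 * m                                                       ∎
    where
    open ≡-Reasoning
    is : Part → Fin n → Bool
    is c x = does (part x ≟ₚ c)
    left-only : ∀ x → not (is middle x) ∧ is (outer left) x ≡ is (outer left) x
    left-only x = part-cases (part x)
      where
      part-cases : ∀ c → not (does (c ≟ₚ middle)) ∧ does (c ≟ₚ outer left) ≡ does (c ≟ₚ outer left)
      part-cases (outer left)  = refl
      part-cases (outer right) = refl
      part-cases middle        = refl
    right-only : ∀ x → not (is middle x) ∧ not (is (outer left) x) ≡ is (outer right) x
    right-only x = part-cases (part x)
      where
      part-cases : ∀ c → not (does (c ≟ₚ middle)) ∧ not (does (c ≟ₚ outer left)) ≡ does (c ≟ₚ outer right)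
      part-cases (outer left)  = refl
      part-cases (outer right) = refl
      part-cases middle        = refl
    regroup : ∀ m → 2 * m + (m + m) ≡ 4 * m
    regroup = solve-∀

  private
    outer-leftover : ∀ m u p d j → m ≡ u + (p + d) → 2 * p ≤ 2 + j → 4 * m ∸ suc (2 * j) ≤ 4 * (u + d) + 3
    outer-leftover _ u p d j refl 2p≤ = m≤n+o⇒m∸n≤o _ (suc (2 * j)) (begin
      4 * (u + (p + d))               ≡⟨ expand u p d ⟩
      4 * (u + d) + 2 * (2 * p)       ≤⟨ +-monoʳ-≤ (4 * (u + d)) (*-monoʳ-≤ 2 2p≤) ⟩
      4 * (u + d) + 2 * (2 + j)       ≡⟨ regroup u d j ⟩
      suc (2 * j) + (4 * (u + d) + 3) ∎)
      where
      open ≤-Reasoning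
      expand : ∀ u p d → 4 * (u + (p + d)) ≡ 4 * (u + d) + 2 * (2 * p)
      expand = solve-∀
      regroup : ∀ u d j → 4 * (u + d) + 2 * (2 + j) ≡ suc (2 * j) + (4 * (u + d) + 3)
      regroup = solve-∀

    middle-leftover : ∀ m u d a b j → 2 * m ≡ u + (j + d) → d ≤ a + b → 4 * m ∸ suc (2 * j) ≤ 2 * (u + (a + b))
    middle-leftover m u d a b j 2m≡ d≤ = m≤n+o⇒m∸n≤o (4 * m) (suc (2 * j)) (begin
      4 * m                           ≡⟨ double m ⟩
      2 * (2 * m)                     ≡⟨ cong (2 *_) 2m≡ ⟩
      2 * (u + (j + d))               ≤⟨ *-monoʳ-≤ 2 (+-monoʳ-≤ u (+-monoʳ-≤ j d≤)) ⟩
      2 * (u + (j + (a + b)))         ≡⟨ regroup u j (a + b) ⟩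
      2 * j + 2 * (u + (a + b))       ≤⟨ +-monoˡ-≤ (2 * (u + (a + b))) (n≤1+n (2 * j)) ⟩
      suc (2 * j) + 2 * (u + (a + b)) ∎)
      where
      open ≤-Reasoning
      double : ∀ m → 4 * m ≡ 2 * (2 * m)
      double = solve-∀
      regroup : ∀ u j e → 2 * (u + (j + e)) ≡ 2 * j + 2 * (u + e)
      regroup = solve-∀

  dead-below : ∀ {dead} → Unique dead → (∀ s → ¬ Large τ (outer s) (among? dead (outer s))) →
               ∀ s → ℕtoℚ (occurrences (outer s) dead) ℚ.< τ
  dead-below distinct small s = subst (λ k → ℕtoℚ k ℚ.< τ) (∣among∣ distinct (outer s)) (ℚₚ.≰⇒> (small s))

  final-bound : ∀ S → Final S → ℕtoℚ (n ∸ suc (2 * edges S)) ℚ.≤ ℕtoℚ 8 ℚ.* τ ℚ.+ ℕtoℚ 3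
  final-bound (state _ j h t dead ch distinct balanced _ dead-small) (outer e , small) =
    ℚₚ.≤-trans (ℕtoℚ-mono-≤ leftover≤) (leftover-outer u d (ℚₚ.≰⇒> small) (dead-below dead-distinct dead-small e))
    where
    dead-distinct : Unique dead
    dead-distinct = unique-++ʳ (h ∷ t) distinct
    u d : ℕ
    u = ∣ unvisited? (h ∷ t ++ dead) (outer e) ∣
    d = occurrences (outer e) dead
    leftover≤ : n ∸ suc (2 * j) ≤ 4 * (u + d) + 3
    leftover≤ = subst (λ k → k ∸ suc (2 * j) ≤ 4 * (u + d) + 3) (sym vertex-count)
      (outer-leftover m u (occurrences (outer e) (h ∷ t)) d j
         (trans (sym (outer-size e)) (part-decomposition (h ∷ t) dead distinct (outer e))) (chain-outer ch e))
  final-bound (state _ j h t dead ch distinct balanced _ dead-small) (middle , small) =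
    ℚₚ.≤-trans (ℕtoℚ-mono-≤ leftover≤)
               (leftover-middle u a b (ℚₚ.≰⇒> small) (dead-below dead-distinct dead-small left)
                                                  (dead-below dead-distinct dead-small right))
    where
    dead-distinct : Unique dead
    dead-distinct = unique-++ʳ (h ∷ t) distinct
    u a b : ℕ
    u = ∣ unvisited? (h ∷ t ++ dead) middle ∣
    a = occurrences (outer left) dead
    b = occurrences (outer right) dead
    size≡ : 2 * m ≡ u + (j + occurrences middle dead)
    size≡ = trans (sym middle-size) (trans (part-decomposition (h ∷ t) dead distinct middle)
                                           (cong (λ k → u + (k + occurrences middle dead)) (chain-middle ch)))
    leftover≤ : n ∸ suc (2 * j) ≤ 2 * (u + (a + b))
    leftover≤ = subst (λ k → k ∸ suc (2 * j) ≤ 2 * (u + (a + b))) (sym vertex-count)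
      (middle-leftover m u (occurrences middle dead) a b j size≡ (balanced-middle balanced))

  long-loose-path : ∃ λ k → LoosePath H k × ℕtoℚ (n ∸ suc (2 * k)) ℚ.≤ ℕtoℚ 8 ℚ.* τ ℚ.+ ℕtoℚ 3
  long-loose-path =
    let S , final = search (2 * n) initial (m≤n+m (2 * n) (progress initial)) in
    edges S , loose-path (chain S) (unique-++ˡ (head S ∷ tail S) (distinct S)) , final-bound S final

module EdgeCounting where
  open import Data.Nat using (zero; suc; _+_; _*_; _≤_; z≤n)
  open import Data.Nat.Properties
    using (≤-trans; ≤-reflexive; m≤m+n; +-mono-≤; *-distribʳ-+; *-identityˡ; *-assoc; module ≤-Reasoning)
  open import Data.Nat.Tactic.RingSolver using (solve-∀)
  open import Data.Nat.ListAction using (sum)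
  open import Data.List using ([]; _∷_; map; allFin)
  open import Data.Vec using ([]; _∷_; tabulate)
  open import Data.Fin.Subset using (Subset; _∈_) renaming (∣_∣ to size)
  open import Data.Fin.Subset.Properties using (_∈?_)
  open Counting using (count-suc; count-cong; count-false; count-split; indicator; does-true)

  size-count : ∀ {n} (p : Subset n) → size p ≡ count (λ x → does (x ∈? p))
  size-count []          = refl
  size-count (true  ∷ p) = trans (cong suc (size-count p)) (sym (count-suc (λ x → does (x ∈? true ∷ p))))
  size-count (false ∷ p) = trans (size-count p) (sym (count-suc (λ x → does (x ∈? false ∷ p))))

  ∈?-tabulate : ∀ {n} (f : Fin n → Bool) x → does (x ∈? tabulate f) ≡ f x
  ∈?-tabulate f zero with f zero
  ... | true  = refl
  ... | false = refl
  ∈?-tabulate f (suc x) = ∈?-tabulate (f ∘ suc) x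

  sum-zero : ∀ {A : Set} (f : A → ℕ) xs → (∀ x → f x ≡ 0) → sum (map f xs) ≡ 0
  sum-zero f []       _    = refl
  sum-zero f (x ∷ xs) f≡0 = cong₂ _+_ (f≡0 x) (sum-zero f xs f≡0)

  sum-≤ : ∀ {A : Set} (f : A → ℕ) (p : A → Bool) K xs → (∀ x → f x ≤ indicator (p x) * K) →
          sum (map f xs) ≤ sum (map (indicator ∘ p) xs) * K
  sum-≤ f p K []       _  = z≤n
  sum-≤ f p K (x ∷ xs) f≤ = ≤-trans (+-mono-≤ (f≤ x) (sum-≤ f p K xs f≤))
                                    (≤-reflexive (sym (*-distribʳ-+ K (indicator (p x)) _)))

  module _ {n} (H : ThreeGraph n) (A₁ A₂ A₃ : Subset n) where

    private
      in₁ in₂ in₃ : Fin n → Bool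
      in₁ x = does (x ∈? A₁)
      in₂ y = does (y ∈? A₂)
      in₃ z = does (z ∈? A₃)

    eCount-empty : (∀ x y z → x ∈ A₁ → y ∈ A₂ → z ∈ A₃ → edge H x y z ≢ true) → eCount H A₁ A₂ A₃ ≡ 0
    eCount-empty no-edge = sum-zero _ (allFin n) λ x → sum-zero _ (allFin n) λ y →
      trans (count-cong (λ z → all-false (in₁ x) (in₂ y) (in₃ z) (edge H x y z) λ x∈ y∈ z∈ e →
                          no-edge x y z (does-true (x ∈? A₁) x∈) (does-true (y ∈? A₂) y∈) (does-true (z ∈? A₃) z∈) e))
            (count-false n)
      where
      all-false : ∀ a b c e → (a ≡ true → b ≡ true → c ≡ true → e ≡ true → ⊥) → a ∧ b ∧ c ∧ e ≡ false
      all-false false _     _     _     _     = refl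
      all-false true  false _     _     _     = refl
      all-false true  true  false _     _     = refl
      all-false true  true  true  false _     = refl
      all-false true  true  true  true  no-e = ⊥-elim (no-e refl refl refl refl)

    eCount-≤ : eCount H A₁ A₂ A₃ ≤ size A₁ * size A₂ * size A₃
    eCount-≤ = begin
      eCount H A₁ A₂ A₃                     ≤⟨ sum-≤ _ in₁ (count in₂ * count in₃) (allFin n) (λ x →
                                                 ≤-trans (sum-≤ _ in₂ (indicator (in₁ x) * count in₃) (allFin n) (triples x))
                                                         (≤-reflexive (regroup (count in₂) (indicator (in₁ x)) (count in₃)))) ⟩
      count in₁ * (count in₂ * count in₃)   ≡⟨ *-assoc (count in₁) (count in₂) (count in₃) ⟨
      count in₁ * count in₂ * count in₃     ≡⟨ cong₂ _*_ (cong₂ _*_ (size-count A₁) (size-count A₂)) (size-count A₃) ⟨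
      size A₁ * size A₂ * size A₃           ∎
      where
      open ≤-Reasoning
      regroup : ∀ b a c → b * (a * c) ≡ a * (b * c)
      regroup = solve-∀
      triples : ∀ x y → count (λ z → in₁ x ∧ in₂ y ∧ in₃ z ∧ edge H x y z) ≤ indicator (in₂ y) * (indicator (in₁ x) * count in₃)
      triples x y with in₁ x | in₂ y
      ... | false | _     = ≤-trans (≤-reflexive (count-false n)) z≤n
      ... | true  | false = ≤-trans (≤-reflexive (count-false n)) z≤n
      ... | true  | true  = begin
        count (λ z → in₃ z ∧ edge H x y z) ≤⟨ m≤m+n _ _ ⟩
        count (λ z → in₃ z ∧ edge H x y z) + count (λ z → in₃ z ∧ not (edge H x y z))
                                           ≡⟨ count-split in₃ (edge H x y) ⟨
        count in₃                          ≡⟨ trans (*-identityˡ _) (*-identityˡ _) ⟨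
        1 * (1 * count in₃)                ∎

module Densities where
  open import Data.Nat using (zero; suc; _*_)
  open import Data.Fin.Subset using () renaming (∣_∣ to size)
  open import Data.Integer using (+_)
  open import Data.Rational using (0ℚ; 1ℚ; _≤_; _/_)
  open import Data.Rational.Properties using (≤-refl)
  open EdgeCounting using (eCount-≤)
  open Rationals using (fraction-≤1; fraction-zero; fraction-nonNeg)

  density-≤1 : ∀ {n} (H : ThreeGraph n) A₁ A₂ A₃ → density H A₁ A₂ A₃ ≤ 1ℚ
  density-≤1 H A₁ A₂ A₃ = bounded (eCount-≤ H A₁ A₂ A₃)
    where
    bounded : eCount H A₁ A₂ A₃ ℕ.≤ size A₁ * size A₂ * size A₃ → density H A₁ A₂ A₃ ≤ 1ℚ
    bounded e≤ with size A₁ * size A₂ * size A₃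
    ... | zero  = fraction-nonNeg 1 0
    ... | suc k = fraction-≤1 e≤

  density-nonNeg : ∀ {n} (H : ThreeGraph n) A₁ A₂ A₃ → 0ℚ ≤ density H A₁ A₂ A₃
  density-nonNeg H A₁ A₂ A₃ with size A₁ * size A₂ * size A₃
  ... | zero  = ≤-refl
  ... | suc k = fraction-nonNeg (eCount H A₁ A₂ A₃) k

  density-empty : ∀ {n} (H : ThreeGraph n) A₁ A₂ A₃ → eCount H A₁ A₂ A₃ ≡ 0 → density H A₁ A₂ A₃ ≡ 0ℚ
  density-empty H A₁ A₂ A₃ e≡0 with size A₁ * size A₂ * size A₃
  ... | zero  = refl
  ... | suc k = trans (cong (λ e → + e / suc k) e≡0) (fraction-zero k)

open import Data.Nat as ℕ using (ℕ; suc; _∸_)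
open import Data.Rational using (ℚ; 0ℚ; _≤_; _<_; _*_; _-_; _+_)
open import Data.Fin.Subset using (Subset; _∈_; _∉_) renaming (∣_∣ to size)
open import Data.Fin using (Fin)
open import Data.Product using (_×_; ∃)
open import Data.Sum using (_⊎_)
open import Relation.Binary.PropositionalEquality using (_≡_)

module RegularTriples where
  open import Data.Vec using (tabulate)
  open import Data.Fin.Subset using (Subset; _∈_) renaming (∣_∣ to size)
  open import Data.Fin.Subset.Properties using (_∈?_)
  open import Data.Fin.Properties using (any?)
  import Data.Bool.Properties as Bool
  open import Data.Rational using (ℚ; 0ℚ; _≤_; _<_; _+_; _-_; _*_; -_)
  open import Data.Rational.Properties
    using (≤-trans; <-≤-trans; <-irrefl; +-identityˡ; ∣-p∣≡∣p∣; 0≤p⇒∣p∣≡p)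
  open Counting using (∣_∣; count-cong; does-true)
  open EdgeCounting using (size-count; ∈?-tabulate; eCount-empty)
  open Densities using (density-empty; density-nonNeg)

  module _ {n} {H : ThreeGraph n} {ε} {V₁ V₂ V₃ : Subset n} {τ} (part : Fin n → Part)
           (regular : IsRegular H ε V₁ V₂ V₃) (ε<density : ε < density H V₁ V₂ V₃)
           (V₁⊇ : ∀ {x} → part x ≡ outer left → x ∈ V₁) (V₂⊇ : ∀ {x} → part x ≡ middle → x ∈ V₂)
           (V₃⊇ : ∀ {x} → part x ≡ outer right → x ∈ V₃)
           (τ₁ : ε * ℕtoℚ (size V₁) ≤ τ) (τ₂ : ε * ℕtoℚ (size V₂) ≤ τ + τ) (τ₃ : ε * ℕtoℚ (size V₃) ≤ τ)
    where

    private
      subset : ∀ {P : Fin n → Set} → Decidable P → Subset n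
      subset P? = tabulate (λ x → does (P? x))

      subset-⊆ : ∀ {P : Fin n → Set} (P? : Decidable P) {x} → x ∈ subset P? → P x
      subset-⊆ P? {x} x∈ = does-true (P? x) (trans (sym (∈?-tabulate (λ y → does (P? y)) x)) (dec-true (x ∈? subset P?) x∈))

      subset-size : ∀ {P : Fin n → Set} (P? : Decidable P) → size (subset P?) ≡ ∣ P? ∣
      subset-size P? = trans (size-count (subset P?)) (count-cong (∈?-tabulate (λ x → does (P? x))))

      large-subset : ∀ (V : Subset n) c {P : Fin n → Set} (P? : Decidable P) →
                     ε * ℕtoℚ (size V) ≤ threshold τ c → Large τ c P? → ε * ℕtoℚ (size V) ≤ ℕtoℚ (size (subset P?))
      large-subset V c P? εV≤ large =
        ≤-trans {ε * ℕtoℚ (size V)} {threshold τ c} εV≤ (subst (λ k → threshold τ c ≤ ℕtoℚ k) (sym (subset-size P?)) large)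

    regular⇒large-triples-span-edges : LargeTriplesSpanEdges H part τ
    regular⇒large-triples-span-edges {A} {B} {C} A? B? C? A⊆ B⊆ C⊆ large-A large-B large-C =
      edge-or-contradiction (any? λ x → any? λ y → any? λ z → A? x ×-dec B? y ×-dec C? z ×-dec edge H x y z Bool.≟ true)
      where
      edge-or-contradiction : Dec (SpansEdge H A B C) → SpansEdge H A B C
      edge-or-contradiction (yes spans) = spans
      edge-or-contradiction (no edgeless) = contradiction (<-≤-trans ε<density (subst (_≤ ε) |0-d|≡d close)) (<-irrefl refl)
        where
        T₁ T₂ T₃ : Subset n
        T₁ = subset A?
        T₂ = subset B?
        T₃ = subset C?
        dV : ℚ
        dV = density H V₁ V₂ V₃
        close : ℚ.∣ density H T₁ T₂ T₃ - dV ∣ ≤ ε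
        close = regular T₁ T₂ T₃ (λ x∈ → V₁⊇ (A⊆ (subset-⊆ A? x∈))) (λ x∈ → V₂⊇ (B⊆ (subset-⊆ B? x∈)))
                                 (λ x∈ → V₃⊇ (C⊆ (subset-⊆ C? x∈)))
                  (large-subset V₁ (outer left) A? τ₁ large-A) (large-subset V₂ middle B? τ₂ large-B)
                  (large-subset V₃ (outer right) C? τ₃ large-C)
        |0-d|≡d : ℚ.∣ density H T₁ T₂ T₃ - dV ∣ ≡ dV
        |0-d|≡d = begin
          ℚ.∣ density H T₁ T₂ T₃ - dV ∣ ≡⟨ cong (λ d → ℚ.∣ d - dV ∣) (density-empty H T₁ T₂ T₃ (eCount-empty H T₁ T₂ T₃
                                           λ x y z x∈ y∈ z∈ e → edgeless (x , y , z , subset-⊆ A? x∈ , subset-⊆ B? y∈ , subset-⊆ C? z∈ , e))) ⟩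
          ℚ.∣ 0ℚ - dV ∣                ≡⟨ cong ℚ.∣_∣ (+-identityˡ (- dV)) ⟩
          ℚ.∣ - dV ∣                  ≡⟨ ∣-p∣≡∣p∣ dV ⟩
          ℚ.∣ dV ∣                    ≡⟨ 0≤p⇒∣p∣≡p (density-nonNeg H V₁ V₂ V₃) ⟩
          dV                          ∎
          where open ≡-Reasoning

module Partition {n} {V₁ V₂ V₃ : Subset n}
  (cover : ∀ x → x ∈ V₁ ⊎ x ∈ V₂ ⊎ x ∈ V₃)
  (V₁∩V₂ : ∀ x → x ∈ V₁ → x ∉ V₂)
  (V₂∩V₃ : ∀ x → x ∈ V₂ → x ∉ V₃)
  (V₁∩V₃ : ∀ x → x ∈ V₁ → x ∉ V₃)
  where
  open import Data.Fin.Subset.Properties using (_∈?_)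
  open Counting using (∣_∣; ∣∣-cong)
  open EdgeCounting using (size-count)

  private
    part-of : ∀ {x} → x ∈ V₁ ⊎ x ∈ V₂ ⊎ x ∈ V₃ → Part
    part-of (inj₁ _)        = outer left
    part-of (inj₂ (inj₁ _)) = middle
    part-of (inj₂ (inj₂ _)) = outer right

  part : Fin n → Part
  part x = part-of (cover x)

  in-V₁ : ∀ x → part x ≡ outer left ⇔ x ∈ V₁
  in-V₁ x with cover x
  ... | inj₁ x∈V₁        = mk⇔ (λ _ → x∈V₁) (λ _ → refl)
  ... | inj₂ (inj₁ x∈V₂) = mk⇔ (λ ()) (λ x∈V₁ → contradiction x∈V₂ (V₁∩V₂ x x∈V₁))
  ... | inj₂ (inj₂ x∈V₃) = mk⇔ (λ ()) (λ x∈V₁ → contradiction x∈V₃ (V₁∩V₃ x x∈V₁))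

  in-V₂ : ∀ x → part x ≡ middle ⇔ x ∈ V₂
  in-V₂ x with cover x
  ... | inj₁ x∈V₁        = mk⇔ (λ ()) (λ x∈V₂ → contradiction x∈V₂ (V₁∩V₂ x x∈V₁))
  ... | inj₂ (inj₁ x∈V₂) = mk⇔ (λ _ → x∈V₂) (λ _ → refl)
  ... | inj₂ (inj₂ x∈V₃) = mk⇔ (λ ()) (λ x∈V₂ → contradiction x∈V₃ (V₂∩V₃ x x∈V₂))

  in-V₃ : ∀ x → part x ≡ outer right ⇔ x ∈ V₃
  in-V₃ x with cover x
  ... | inj₁ x∈V₁        = mk⇔ (λ ()) (λ x∈V₃ → contradiction x∈V₃ (V₁∩V₃ x x∈V₁))
  ... | inj₂ (inj₁ x∈V₂) = mk⇔ (λ ()) (λ x∈V₃ → contradiction x∈V₃ (V₂∩V₃ x x∈V₂))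
  ... | inj₂ (inj₂ x∈V₃) = mk⇔ (λ _ → x∈V₃) (λ _ → refl)

  part-size : ∀ {c} {V : Subset n} → (∀ x → part x ≡ c ⇔ x ∈ V) → ∣ inPart? part c ∣ ≡ size V
  part-size {c} {V} in-V = trans (∣∣-cong (inPart? part c) (_∈? V) in-V) (sym (size-count V))

open import Data.Rational.Properties using (≤-trans; ≤-reflexive; <-trans; <-≤-trans; <⇒≤; +-monoˡ-≤; *-assoc)
open Rationals using (÷′-pos; ≤-÷′; 0<-difference; ℕtoℚ-double; ℕtoℚ-positive; *-pos; half-below; bounded-below⇒positive)
open Densities using (density-≤1)
open RegularTriples using (regular⇒large-triples-span-edges)

proposition2p6 :
    (ε d : ℚ) → 0ℚ < ε → ℕtoℚ 2 * ε < d →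
    (m : ℕ) → d ÷' (ε * (d - ℕtoℚ 2 * ε)) ≤ ℕtoℚ m →
    (n : ℕ) (H : ThreeGraph n) (V₁ V₂ V₃ : Subset n) →
    (∀ x → x ∈ V₁ ⊎ x ∈ V₂ ⊎ x ∈ V₃) →
    (∀ x → x ∈ V₁ → x ∉ V₂) →
    (∀ x → x ∈ V₂ → x ∉ V₃) →
    (∀ x → x ∈ V₁ → x ∉ V₃) →
    size V₁ ≡ m → size V₂ ≡ 2 ℕ.* m → size V₃ ≡ m →
    IsRegularWith H ε d V₁ V₂ V₃ →
    ∃ λ (k : ℕ) → LoosePath H k ×
      ℕtoℚ (n ∸ suc (2 ℕ.* k)) ≤ ((ℕtoℚ 8 * ε * ℕtoℚ m) ÷' d) + ℕtoℚ 3
proposition2p6 ε d 0<ε 2ε<d m m-bound n H V₁ V₂ V₃ cover V₁∩V₂ V₂∩V₃ V₁∩V₃ |V₁| |V₂| |V₃| (regular , d≤density) =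
  let k , path , leftover = LoosePathSearch.long-loose-path H part τ-pos m-pos outer-size middle-size dense
  in k , path , ≤-trans leftover (+-monoˡ-≤ (ℕtoℚ 3) (subst (_≤ (ℕtoℚ 8 * ε * ℕtoℚ m) ÷' d) (*-assoc (ℕtoℚ 8) ε (ℕtoℚ m))
                                                         (≤-÷′ 0≤8εm 0<d (≤-trans d≤density (density-≤1 H V₁ V₂ V₃)))))
  where
  open Partition cover V₁∩V₂ V₂∩V₃ V₁∩V₃
  ε<d : ε < d
  ε<d = half-below 0<ε 2ε<d
  0<d : 0ℚ < d
  0<d = <-trans 0<ε ε<d
  -- The lower bound on m is needed only to see that m, hence the vertex set, is nonempty.
  m-pos : 0 ℕ.< m
  m-pos = bounded-below⇒positive (÷′-pos 0<d (*-pos 0<ε (0<-difference 2ε<d))) m-bound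
  τ-pos : 0ℚ < ε * ℕtoℚ m
  τ-pos = *-pos 0<ε (ℕtoℚ-positive m-pos)
  0≤8εm : 0ℚ ≤ ℕtoℚ 8 * ε * ℕtoℚ m
  0≤8εm = <⇒≤ (*-pos (*-pos (ℕtoℚ-positive {8} (ℕ.s≤s ℕ.z≤n)) 0<ε) (ℕtoℚ-positive m-pos))
  outer-size : ∀ s → Counting.∣ inPart? part (outer s) ∣ ≡ m
  outer-size left  = trans (part-size in-V₁) |V₁|
  outer-size right = trans (part-size in-V₃) |V₃|
  middle-size : Counting.∣ inPart? part middle ∣ ≡ 2 ℕ.* m
  middle-size = trans (part-size in-V₂) |V₂|
  dense : LargeTriplesSpanEdges H part (ε * ℕtoℚ m)
  dense = regular⇒large-triples-span-edges part regular (<-≤-trans ε<d d≤density)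
            (Equivalence.to (in-V₁ _)) (Equivalence.to (in-V₂ _)) (Equivalence.to (in-V₃ _))
            (≤-reflexive (cong (λ k → ε * ℕtoℚ k) |V₁|))
            (≤-reflexive (trans (cong (λ k → ε * ℕtoℚ k) |V₂|) (ℕtoℚ-double ε m)))
            (≤-reflexive (cong (λ k → ε * ℕtoℚ k) |V₃|))
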